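{- Let $G$ be a $3$-edge-connected undirected graph (possibly with multiple edges) and $T$ a DFS spanning tree of $G$ rooted at $r$. Let $v$ be a vertex, let $m=\tilde{M}(v)$, and let $u$ be the minimum vertex in $M^{ -1}(m)$ strictly greater than $v$. Then there exists a back-edge $e$ such that $B(v)=B(u)\sqcup\{e\}$ if and only if: $\mathit{b\_count}(v)=\mathit{b\_count}(u)+1$, $l_2(M(v))\geq v$, and either $M(v)$ has no $\mathit{low2}$ child or $\mathit{low1}(c_2(M(v)))\geq v$.
   Context: Vertices are identified with their DFS preorder numbers. A vertex $u$ is an ancestor of $v$ ($v$ a descendant of $u$) if the tree path from $r$ to $v$ contains $u$ (every vertex is an ancestor and descendant of itself). Non-tree edges are back-edges; a back-edge is written $(x,y)$ with $x$ a descendant of $y$. $B(v)$ is the set of back-edges $(x,y)$ with $x$ a descendant of $v$ and $y$ a proper ancestor of $v$, and $\mathit{b\_count}(v)=|B(v)|$; $\sqcup$ denotes disjoint union. $l_1(v)$ is the smallest $y$ such that there is a back-edge $(v,y)$, or $v$ if none; $l_2(v)$ is the smallest $y$ such that there is a back-edge $(v,y)$ different from the back-edge $(v,l_1(v))$, or $v$ if none. For $v\neq r$, $\mathit{low1}(v)=\min\{y:\exists (x,y)\in B(v)\}$. The children of a vertex $w$ sorted in non-decreasing order of $\mathit{low1}$ are $c_1(w),c_2(w),\dots$ (ties broken arbitrarily but fixed; $c_i(w)=\emptyset$ if $w$ has fewer than $i$ children); $c_2(w)$ is the $\mathit{low2}$ child of $w$. $\mathit{nca}$ denotes nearest common ancestor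 in $T$. $M(v)=\mathit{nca}\{x:\exists(x,y)\in B(v)\}$; $\tilde M(v)=\mathit{nca}\{x:\exists(x,y)\in B(v),\ x \text{ a proper descendant of } M(v)\}$ (undefined if the set is empty). For a vertex $m$, $M^{ -1}(m)=\{w: M(w)=m\}$. -}

module Defs where

open import Data.Nat as ℕ using (ℕ; zero; suc; _⊓_; _≤ᵇ_)
open import Data.Nat.Properties using (<-≤-trans; ≤-refl)
open import Data.Fin as Fin using (Fin; toℕ; _≟_; _<_; _≤_)
open import Data.Fin.Properties using ()
open import Data.List using (List; []; _∷_; filter; filterᵇ; length; map; foldr; allFin)
open import Data.Maybe using (Maybe; just; nothing; maybe)
open import Data.Bool using (Bool; true; false; not; _∧_; if_then_else_)
open import Data.Product using (Σ; ∃; ∃-syntax; _×_; _,_)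
open import Data.Sum using (_⊎_)
open import Relation.Nullary using (Dec; yes; no; ¬_; _×-dec_; ¬?)
open import Relation.Nullary.Decidable using (⌊_⌋)
open import Relation.Binary.PropositionalEquality using (_≡_; _≢_; refl)
open import Relation.Unary using (Pred)

-- Vertices of a graph with (suc n) vertices are Fin (suc n), identified with
-- their DFS preorder numbers; the root r is the vertex 0.
Vertex : ℕ → Set
Vertex n = Fin (suc n)

-- A rooted spanning tree on the vertices, given by parent pointers.
-- (parent of the root is irrelevant.)  Parents have smaller numbers.
record RootedTree (n : ℕ) : Set where
  field
    parent  : Vertex n → Vertex n
    parent< : ∀ v → v ≢ Fin.zero → parent v < v

module _ {n : ℕ} (T : RootedTree n) where
  open RootedTree T

  data Anc (u : Vertex n) : Vertex n → Set where
    anc-refl : Anc u u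
    anc-step : ∀ {v} → v ≢ Fin.zero → Anc u (parent v) → Anc u v

  ProperAnc : Vertex n → Vertex n → Set
  ProperAnc u v = Anc u v × u ≢ v

  private
    anc-fuel : ∀ (f : ℕ) u v → toℕ v ℕ.< f → Dec (Anc u v)
    anc-fuel zero u v ()
    anc-fuel (suc f) u v (ℕ.s≤s v≤f) with u ≟ v
    ... | yes refl = yes anc-refl
    ... | no u≢v with v ≟ Fin.zero
    ...   | yes v≡0 = no λ { anc-refl → u≢v refl ; (anc-step nz _) → nz v≡0 }
    ...   | no nz with anc-fuel f u (parent v) (<-≤-trans (parent< v nz) v≤f)
    ...     | yes a = yes (anc-step nz a)
    ...     | no ¬a = no λ { anc-refl → u≢v refl ; (anc-step _ a) → ¬a a }

  anc? : ∀ u v → Dec (Anc u v)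
  anc? u v = anc-fuel (suc (toℕ v)) u v ≤-refl

  -- The numbering is a preorder numbering of T: every subtree occupies
  -- a contiguous interval of numbers starting at its root.
  IsPreorder : Set
  IsPreorder = ∀ a w b → Anc a b → a ≤ w → w ≤ b → Anc a w

  IsNCA : Pred (Vertex n) _ → Vertex n → Set
  IsNCA S m = (∃[ s ] S s)
            × (∀ s → S s → Anc m s)
            × (∀ a → (∀ s → S s → Anc a s) → Anc a m)

-- The non-tree edges of G: back-edges (tail i , head i) with head i a proper
-- ancestor of tail i (multiple edges allowed; edges are identified by index).
record BackEdges {n : ℕ} (T : RootedTree n) (k : ℕ) : Set where
  field
    tail   : Fin k → Vertex n
    head   : Fin k → Vertex n
    isBack : ∀ i → ProperAnc T (head i) (tail i)

-- first element of a list minimising a weight (ties: earliest), if any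
argmin : {A : Set} → (A → ℕ) → List A → Maybe A
argmin f [] = nothing
argmin f (a ∷ as) with argmin f as
... | nothing = just a
... | just b  = if f a ≤ᵇ f b then just a else just b

isThis : {m : ℕ} → Maybe (Fin m) → Fin m → Bool
isThis nothing  i = false
isThis (just e) i = ⌊ i ≟ e ⌋

module _ {n k : ℕ} (T : RootedTree n) (E : BackEdges T k) where
  open RootedTree T
  open BackEdges E

  InB : Vertex n → Fin k → Set
  InB v i = Anc T v (tail i) × ProperAnc T (head i) v

  inB? : ∀ v i → Dec (InB v i)
  inB? v i = anc? T v (tail i) ×-dec (anc? T (head i) v ×-dec ¬? (head i ≟ v))

  b-count : Vertex n → ℕ
  b-count v = length (filter (inB? v) (allFin k))

  DisjUnionOne : Vertex n → Vertex n → Fin k → Set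
  DisjUnionOne v u e = (∀ i → InB v i → InB u i ⊎ i ≡ e)
                     × (∀ i → InB u i ⊎ i ≡ e → InB v i)
                     × ¬ InB u e

  edgesFrom : Vertex n → List (Fin k)
  edgesFrom w = filter (λ i → tail i ≟ w) (allFin k)

  headℕ : Fin k → ℕ
  headℕ i = toℕ (head i)

  e1 : Vertex n → Maybe (Fin k)
  e1 w = argmin headℕ (edgesFrom w)

  l1 : Vertex n → ℕ
  l1 w = maybe headℕ (toℕ w) (e1 w)

  l2 : Vertex n → ℕ
  l2 w = maybe headℕ (toℕ w)
           (argmin headℕ (filterᵇ (λ i → not (isThis (e1 w) i)) (edgesFrom w)))

  -- low1(v) = min { y : (x,y) ∈ B(v) }  (meaningful for v ≠ r)
  low1 : Vertex n → ℕ
  low1 v = foldr _⊓_ (toℕ v) (map headℕ (filter (inB? v) (allFin k)))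

  children : Vertex n → List (Vertex n)
  children w = filterᵇ (λ c → not ⌊ c ≟ Fin.zero ⌋ ∧ ⌊ parent c ≟ w ⌋)
                       (allFin (suc n))

  -- children sorted by low1 (ties broken by vertex number): c1, c2
  c1 : Vertex n → Maybe (Vertex n)
  c1 w = argmin low1 (children w)

  c2 : Vertex n → Maybe (Vertex n)
  c2 w = argmin low1 (filterᵇ (λ c → not (isThis (c1 w) c)) (children w))

  TailsB : Vertex n → Pred (Vertex n) _
  TailsB v x = ∃[ i ] (InB v i × tail i ≡ x)

  TailsB-below : Vertex n → Vertex n → Pred (Vertex n) _
  TailsB-below v mv x = ∃[ i ] (InB v i × tail i ≡ x × ProperAnc T mv x)

  -- edges of G: tree edge (c , parent c) for c ≠ r, or a back-edge
  Edge : Set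
  Edge = Vertex n ⊎ Fin k

  data Joins : Edge → Vertex n → Vertex n → Set where
    tree↑ : ∀ c → c ≢ Fin.zero → Joins (Data.Sum.inj₁ c) c (parent c)
    tree↓ : ∀ c → c ≢ Fin.zero → Joins (Data.Sum.inj₁ c) (parent c) c
    back↑ : ∀ i → Joins (Data.Sum.inj₂ i) (tail i) (head i)
    back↓ : ∀ i → Joins (Data.Sum.inj₂ i) (head i) (tail i)

  data Reach (f₁ f₂ : Edge) (a : Vertex n) : Vertex n → Set where
    here : Reach f₁ f₂ a a
    step : ∀ {b c} e → e ≢ f₁ → e ≢ f₂ → Reach f₁ f₂ a b → Joins e b c → Reach f₁ f₂ a c

  ThreeEdgeConnected : Set
  ThreeEdgeConnected = ∀ f₁ f₂ a b → Reach f₁ f₂ a b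

{-# OPTIONS --safe #-}
module Submission where

-- Put z = M(v). The tails of B(v) lie below z, and those different from z lie below m, hence
-- below u, because v, z, m and u lie on one tree path with u an ancestor of m. So every edge of
-- B(v) is in B(u) except the edges leaving z itself, and these are in B(u) iff u is an ancestor
-- of z. Hence B(v) = B(u) ⊔ {e} says exactly that u is not an ancestor of z and a single edge
-- leaves z above v; counting turns the inclusions into b_count(v) = b_count(u) + 1, and
-- l2(z) ≥ v rules out a second edge from z above v. The low2 condition is then automatic:
-- a child of z with low1 < v has an edge of B(v) in its subtree with tail below m, so it lies
-- on the path from z to m ≠ z, and at most one child of z does.

open import Defs
open import Data.Nat using (ℕ; _≤_; _+_)
open import Data.Fin using (Fin; toℕ; _<_; zero)
open import Data.Maybe using (just; nothing)
open import Data.Product using (∃-syntax; _×_)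
open import Data.Sum using (_⊎_)
open import Function.Bundles using (_⇔_)
open import Relation.Binary.PropositionalEquality using (_≡_; _≢_)

import Data.Nat as ℕ
open import Data.Nat.Properties
  using (≤-refl; ≤-trans; ≤-antisym; <⇒≤; <⇒≱; ≤-<-trans; <-trans; m≤n⇒m≤1+n; ≤∧≢⇒<;
         ≰⇒>; ≮⇒≥; ≤ᵇ⇒≤; ≤⇒≤ᵇ; ⊓-glb; +-comm; <-irrefl; n≮0)
open import Data.Fin using (_≟_)
open import Data.Fin.Properties using (toℕ-injective; any?)
open import Data.Maybe using (Maybe)
open import Data.Bool using (true; false; not; _∧_; T; T?)
open import Data.List using (List; []; _∷_; filter; filterᵇ; length; map; foldr; allFin)
open import Data.List.Properties using (foldr-preservesᵇ)
open import Data.List.Membership.Propositional using (_∈_)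
open import Data.List.Membership.Propositional.Properties using (∈-filter⁺; ∈-filter⁻; ∈-allFin)
open import Data.List.Relation.Unary.Any using (here; there)
open import Data.List.Relation.Unary.All as All using (All)
open import Data.List.Relation.Unary.All.Properties using (map⁺)
open import Data.List.Relation.Unary.AllPairs using (_∷_)
open import Data.List.Relation.Unary.Unique.Propositional using (Unique)
open import Data.List.Relation.Unary.Unique.Propositional.Properties using (allFin⁺)
open import Data.Product using (_,_; proj₁; proj₂)
open import Data.Sum using (inj₁; inj₂)
open import Data.Empty using (⊥-elim)
open import Function.Bundles using (mk⇔)
open import Relation.Nullary using (yes; no; ¬_; _×-dec_)
open import Relation.Nullary.Decidable using (⌊_⌋; _⊎-dec_)
open import Level using (Level)
open import Relation.Unary using (Pred; Decidable)
open import Relation.Binary.PropositionalEquality using (refl; sym; trans; subst)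

module _ {a p q : Level} {A : Set a} {P : Pred A p} {Q : Pred A q} (P? : Decidable P) (Q? : Decidable Q) where

  length-filter-mono : ∀ xs → (∀ {x} → x ∈ xs → P x → Q x)
                     → length (filter P? xs) ≤ length (filter Q? xs)
  length-filter-mono [] _ = ℕ.z≤n
  length-filter-mono (x ∷ xs) P⊆Q with P? x | Q? x
  ... | yes px | yes _  = ℕ.s≤s (length-filter-mono xs (λ y∈ → P⊆Q (there y∈)))
  ... | yes px | no ¬qx = ⊥-elim (¬qx (P⊆Q (here refl) px))
  ... | no _   | yes _  = m≤n⇒m≤1+n (length-filter-mono xs (λ y∈ → P⊆Q (there y∈)))
  ... | no _   | no _   = length-filter-mono xs (λ y∈ → P⊆Q (there y∈))

  length-filter-mono-< : ∀ xs → (∀ {x} → P x → Q x) → ∀ {j} → j ∈ xs → Q j → ¬ P j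
                       → length (filter P? xs) ℕ.< length (filter Q? xs)
  length-filter-mono-< (x ∷ xs) P⊆Q j∈ qj ¬pj with P? x | Q? x | j∈
  ... | yes px | _      | here refl = ⊥-elim (¬pj px)
  ... | no _   | no ¬qx | here refl = ⊥-elim (¬qx qj)
  ... | no _   | yes _  | here refl = ℕ.s≤s (length-filter-mono xs (λ _ → P⊆Q))
  ... | yes px | no ¬qx | there _   = ⊥-elim (¬qx (P⊆Q px))
  ... | yes _  | yes _  | there j∈′ = ℕ.s≤s (length-filter-mono-< xs P⊆Q j∈′ qj ¬pj)
  ... | no _   | yes _  | there j∈′ = m≤n⇒m≤1+n (length-filter-mono-< xs P⊆Q j∈′ qj ¬pj)
  ... | no _   | no _   | there j∈′ = length-filter-mono-< xs P⊆Q j∈′ qj ¬pj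

  length-filter-≤-suc : ∀ xs → Unique xs → ∀ e → (∀ {x} → P x → Q x ⊎ x ≡ e)
                      → length (filter P? xs) ≤ ℕ.suc (length (filter Q? xs))
  length-filter-≤-suc [] _ e _ = ℕ.z≤n
  length-filter-≤-suc (x ∷ xs) (x∉xs ∷ uniq) e P⊆Q∪e with P? x | Q? x
  ... | yes _ | yes _ = ℕ.s≤s (length-filter-≤-suc xs uniq e P⊆Q∪e)
  ... | no _  | yes _ = m≤n⇒m≤1+n (length-filter-≤-suc xs uniq e P⊆Q∪e)
  ... | no _  | no _  = length-filter-≤-suc xs uniq e P⊆Q∪e
  ... | yes px | no ¬qx = ℕ.s≤s (length-filter-mono xs P⊆Q)
    where
    x≡e : x ≡ e
    x≡e with P⊆Q∪e px
    ... | inj₁ qx = ⊥-elim (¬qx qx)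
    ... | inj₂ eq = eq

    P⊆Q : ∀ {y} → y ∈ xs → P y → Q y
    P⊆Q {y} y∈ py with P⊆Q∪e py
    ... | inj₁ qy = qy
    ... | inj₂ y≡e = ⊥-elim (All.lookup x∉xs y∈ (trans x≡e (sym y≡e)))

module _ {A : Set} (f : A → ℕ) where

  data ArgminView (xs : List A) : Maybe A → Set where
    empty   : (∀ {x} → ¬ x ∈ xs) → ArgminView xs nothing
    minimum : ∀ {b} → b ∈ xs → (∀ {x} → x ∈ xs → f b ≤ f x) → ArgminView xs (just b)

  argmin-view : ∀ xs → ArgminView xs (argmin f xs)
  argmin-view [] = empty λ ()
  argmin-view (x ∷ xs) with argmin f xs | argmin-view xs
  ... | nothing | empty ∉xs =
          minimum (here refl) λ { (here refl) → ≤-refl ; (there y∈) → ⊥-elim (∉xs y∈) }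
  ... | just b  | minimum b∈ b-min with f x ℕ.≤ᵇ f b in x≤ᵇb
  ...   | true  = minimum (here refl) λ
          { (here refl) → ≤-refl
          ; (there y∈)  → ≤-trans (≤ᵇ⇒≤ (f x) (f b) (subst T (sym x≤ᵇb) _)) (b-min y∈) }
  ...   | false = minimum (there b∈) λ
          { (here refl) → <⇒≤ (≰⇒> λ x≤b → subst T x≤ᵇb (≤⇒≤ᵇ x≤b))
          ; (there y∈)  → b-min y∈ }

module _ {m : ℕ} where

  without : Maybe (Fin m) → List (Fin m) → List (Fin m)
  without r = filterᵇ (λ i → not (isThis r i))

  ∈-without-just⁻ : ∀ {a y xs} → y ∈ without (just a) xs → y ∈ xs × y ≢ a
  ∈-without-just⁻ {a} {y} y∈ with ∈-filter⁻ (λ i → T? (not (isThis (just a) i))) y∈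
  ... | y∈xs , kept with y ≟ a
  ...   | yes _  = ⊥-elim kept
  ...   | no y≢a = y∈xs , y≢a

  ∈-without-just⁺ : ∀ {a y xs} → y ∈ xs → y ≢ a → y ∈ without (just a) xs
  ∈-without-just⁺ {a} {y} y∈ y≢a = ∈-filter⁺ (λ i → T? (not (isThis (just a) i))) y∈ kept
    where
    kept : T (not (isThis (just a) y))
    kept with y ≟ a
    ... | yes y≡a = y≢a y≡a
    ... | no _    = _

  ∈-without-nothing⁻ : ∀ {y xs} → y ∈ without nothing xs → y ∈ xs
  ∈-without-nothing⁻ y∈ = proj₁ (∈-filter⁻ (λ i → T? (not (isThis nothing i))) y∈)

  -- l2 (on the back-edges leaving a vertex) and c2 (on its children) both unfold to this.
  secondArgmin : (Fin m → ℕ) → List (Fin m) → Maybe (Fin m)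
  secondArgmin f xs = argmin f (without (argmin f xs) xs)

  secondArgmin-just : ∀ f xs {s} → secondArgmin f xs ≡ just s
                    → s ∈ xs × ∃[ a ] (a ∈ xs × a ≢ s × f a ≤ f s)
  secondArgmin-just f xs eq = go (argmin-view f xs) (argmin-view f _) eq
    where
    go : ∀ {r₁ r₂ s} → ArgminView f xs r₁ → ArgminView f (without r₁ xs) r₂ → r₂ ≡ just s
       → s ∈ xs × ∃[ a ] (a ∈ xs × a ≢ s × f a ≤ f s)
    go (empty ∉xs) (minimum s∈ _) refl = ⊥-elim (∉xs (∈-without-nothing⁻ s∈))
    go (minimum a∈ a-min) (minimum s∈ _) refl =
      let s∈xs , s≢a = ∈-without-just⁻ s∈
      in s∈xs , _ , a∈ , (λ a≡s → s≢a (sym a≡s)) , a-min s∈xs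

  secondArgmin-pair : ∀ f xs {a b} → a ∈ xs → b ∈ xs → a ≢ b
                    → ∃[ s ] (secondArgmin f xs ≡ just s × (f s ≤ f a ⊎ f s ≤ f b))
  secondArgmin-pair f xs {a} {b} a∈ b∈ a≢b = go (argmin-view f xs) (argmin-view f _)
    where
    below : ∀ {r r′ y} → ArgminView f (without r xs) r′ → y ∈ without r xs
          → (∀ {s} → f s ≤ f y → f s ≤ f a ⊎ f s ≤ f b)
          → ∃[ s ] (r′ ≡ just s × (f s ≤ f a ⊎ f s ≤ f b))
    below (empty ∉) y∈ _ = ⊥-elim (∉ y∈)
    below (minimum _ s-min) y∈ pick = _ , refl , pick (s-min y∈)

    go : ∀ {r₁ r₂} → ArgminView f xs r₁ → ArgminView f (without r₁ xs) r₂
       → ∃[ s ] (r₂ ≡ just s × (f s ≤ f a ⊎ f s ≤ f b))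
    go (empty ∉xs) _ = ⊥-elim (∉xs a∈)
    go {just p} (minimum _ _) second with a ≟ p
    ... | yes refl = below second (∈-without-just⁺ b∈ λ b≡a → a≢b (sym b≡a)) inj₂
    ... | no a≢p   = below second (∈-without-just⁺ a∈ a≢p) inj₁

module Tree {n : ℕ} (T : RootedTree n) where
  open RootedTree T

  IsChild : Vertex n → Vertex n → Set
  IsChild z c = c ≢ zero × parent c ≡ z

  anc⇒≤ : ∀ {a b} → Anc T a b → toℕ a ≤ toℕ b
  anc⇒≤ anc-refl            = ≤-refl
  anc⇒≤ (anc-step b≢0 a↝pb) = ≤-trans (anc⇒≤ a↝pb) (<⇒≤ (parent< _ b≢0))

  anc-trans : ∀ {a b c} → Anc T a b → Anc T b c → Anc T a c
  anc-trans a↝b anc-refl            = a↝b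
  anc-trans a↝b (anc-step c≢0 b↝pc) = anc-step c≢0 (anc-trans a↝b b↝pc)

  anc-antisym : ∀ {a b} → Anc T a b → Anc T b a → a ≡ b
  anc-antisym a↝b b↝a = toℕ-injective (≤-antisym (anc⇒≤ a↝b) (anc⇒≤ b↝a))

  child-anc : ∀ {z c} → IsChild z c → Anc T z c
  child-anc (c≢0 , refl) = anc-step c≢0 anc-refl

  child-¬anc-parent : ∀ {z c} → IsChild z c → ¬ Anc T c z
  child-¬anc-parent (c≢0 , refl) c↝z = <⇒≱ (parent< _ c≢0) (anc⇒≤ c↝z)

  anc-total : ∀ {a b x} → Anc T a x → Anc T b x → Anc T a b ⊎ Anc T b a
  anc-total anc-refl               b↝x                = inj₂ b↝x
  anc-total a↝x@(anc-step _ _)     anc-refl           = inj₁ a↝x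
  anc-total (anc-step _ a↝px)      (anc-step _ b↝px)  = anc-total a↝px b↝px

  anc-total-< : ∀ {a b x} → Anc T a x → Anc T b x → toℕ a ℕ.< toℕ b → Anc T a b
  anc-total-< a↝x b↝x a<b with anc-total a↝x b↝x
  ... | inj₁ a↝b = a↝b
  ... | inj₂ b↝a = ⊥-elim (<⇒≱ a<b (anc⇒≤ b↝a))

  child-anc-descendant : ∀ {z c m t} → IsChild z c → Anc T z m → z ≢ m
                       → Anc T m t → Anc T c t → Anc T c m
  child-anc-descendant child z↝m z≢m m↝t c↝t with anc-total c↝t m↝t
  ... | inj₁ c↝m = c↝m
  ... | inj₂ anc-refl = anc-refl
  ... | inj₂ (anc-step _ m↝pc) =
          ⊥-elim (z≢m (anc-antisym z↝m (subst (Anc T _) (proj₂ child) m↝pc)))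

  children-anc-unique : ∀ {z c c′ m} → IsChild z c → IsChild z c′
                      → Anc T c m → Anc T c′ m → c ≡ c′
  children-anc-unique child child′ c↝m c′↝m with anc-total c↝m c′↝m
  ... | inj₁ anc-refl = refl
  ... | inj₂ anc-refl = refl
  ... | inj₁ (anc-step _ c↝pc′) =
          ⊥-elim (child-¬anc-parent child (subst (Anc T _) (proj₂ child′) c↝pc′))
  ... | inj₂ (anc-step _ c′↝pc) =
          ⊥-elim (child-¬anc-parent child′ (subst (Anc T _) (proj₂ child) c′↝pc))

module BackEdgeFacts {n k : ℕ} (T : RootedTree n) (E : BackEdges T k) where
  open RootedTree T
  open BackEdges E
  open Tree T

  ∈-edgesFrom⁻ : ∀ {z i} → i ∈ edgesFrom T E z → tail i ≡ z
  ∈-edgesFrom⁻ {z} i∈ = proj₂ (∈-filter⁻ (λ i → tail i ≟ z) {xs = allFin k} i∈)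

  ∈-edgesFrom⁺ : ∀ {z i} → tail i ≡ z → i ∈ edgesFrom T E z
  ∈-edgesFrom⁺ {z} {i} = ∈-filter⁺ (λ i → tail i ≟ z) (∈-allFin i)

  ∈-children⁻ : ∀ {w c} → c ∈ children T E w → IsChild w c
  ∈-children⁻ {w} {c} c∈
    with ∈-filter⁻ (λ c → T? (not ⌊ c ≟ zero ⌋ ∧ ⌊ parent c ≟ w ⌋)) {xs = allFin (ℕ.suc n)} c∈
  ... | _ , kept with c ≟ zero | parent c ≟ w
  ...   | yes _  | _        = ⊥-elim kept
  ...   | no _   | no _     = ⊥-elim kept
  ...   | no c≢0 | yes pc≡w = c≢0 , pc≡w

  TwoEdgesBelow : Vertex n → ℕ → Set
  TwoEdgesBelow z x = ∃[ a ] ∃[ b ] (a ≢ b × tail a ≡ z × tail b ≡ z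
                                    × headℕ T E a ℕ.< x × headℕ T E b ℕ.< x)

  l2<⇒two-edges-below : ∀ {z x} → x ≤ toℕ z → l2 T E z ℕ.< x → TwoEdgesBelow z x
  l2<⇒two-edges-below {z} x≤z l2<x with secondArgmin (headℕ T E) (edgesFrom T E z) in eq
  ... | nothing = ⊥-elim (<⇒≱ l2<x x≤z)
  ... | just s with secondArgmin-just (headℕ T E) (edgesFrom T E z) eq
  ...   | s∈ , a , a∈ , a≢s , ha≤hs =
          a , s , a≢s , ∈-edgesFrom⁻ a∈ , ∈-edgesFrom⁻ s∈ , ≤-<-trans ha≤hs l2<x , l2<x

  two-edges-below⇒l2< : ∀ {z x} → TwoEdgesBelow z x → l2 T E z ℕ.< x
  two-edges-below⇒l2< {z} (a , b , a≢b , ta , tb , ha , hb)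
    with secondArgmin-pair (headℕ T E) (edgesFrom T E z) (∈-edgesFrom⁺ ta) (∈-edgesFrom⁺ tb) a≢b
  ... | _ , eq , inj₁ hs≤ha rewrite eq = ≤-<-trans hs≤ha ha
  ... | _ , eq , inj₂ hs≤hb rewrite eq = ≤-<-trans hs≤hb hb

  c2-just : ∀ {z c′} → c2 T E z ≡ just c′
          → IsChild z c′ × ∃[ c ] (IsChild z c × c ≢ c′ × low1 T E c ≤ low1 T E c′)
  c2-just {z} eq with secondArgmin-just (low1 T E) (children T E z) eq
  ... | c′∈ , c , c∈ , c≢c′ , low≤ = ∈-children⁻ c′∈ , c , ∈-children⁻ c∈ , c≢c′ , low≤

  low1<⇒edge-below : ∀ {c x} → x ≤ toℕ c → low1 T E c ℕ.< x
                   → ∃[ i ] (InB T E c i × headℕ T E i ℕ.< x)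
  low1<⇒edge-below {c} {x} x≤c low1<x with any? (λ i → inB? T E c i ×-dec (headℕ T E i ℕ.<? x))
  ... | yes edge = edge
  ... | no ∄edge = ⊥-elim (<⇒≱ low1<x x≤low1)
    where
    x≤head : ∀ {i} → i ∈ filter (inB? T E c) (allFin k) → x ≤ headℕ T E i
    x≤head i∈ = ≮⇒≥ λ head<x → ∄edge (_ , proj₂ (∈-filter⁻ (inB? T E c) {xs = allFin k} i∈) , head<x)

    x≤low1 : x ≤ low1 T E c
    x≤low1 = foldr-preservesᵇ {P = x ≤_} ⊓-glb x≤c (map⁺ (All.tabulate x≤head))

module Setting {n k : ℕ} (T : RootedTree n) (E : BackEdges T k) (M : Vertex n → Vertex n)
  (M-nca : ∀ w → w ≢ zero → IsNCA T (TailsB T E w) (M w))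
  (v : Vertex n) (v≢0 : v ≢ zero) (m : Vertex n) (m-nca : IsNCA T (TailsB-below T E v (M v)) m)
  (u : Vertex n) (Mu≡m : M u ≡ m) (v<u : v < u) where
  open RootedTree T
  open BackEdges E
  open Tree T
  open BackEdgeFacts T E

  z : Vertex n
  z = M v

  v↝z : Anc T v z
  v↝z = proj₂ (proj₂ (M-nca v v≢0)) v λ { _ (_ , i∈Bv , refl) → proj₁ i∈Bv }

  z↝tail : ∀ {i} → InB T E v i → Anc T z (tail i)
  z↝tail i∈Bv = proj₁ (proj₂ (M-nca v v≢0)) _ (_ , i∈Bv , refl)

  z↝m : Anc T z m
  z↝m = proj₂ (proj₂ m-nca) z λ { _ (_ , _ , refl , z↝x , _) → z↝x }

  m↝tail : ∀ {i} → InB T E v i → tail i ≢ z → Anc T m (tail i)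
  m↝tail i∈Bv ti≢z =
    proj₁ (proj₂ m-nca) _ (_ , i∈Bv , refl , z↝tail i∈Bv , λ z≡ti → ti≢z (sym z≡ti))

  u↝m : Anc T u m
  u↝m = subst (Anc T u) Mu≡m
          (proj₂ (proj₂ (M-nca u u≢0)) u λ { _ (_ , i∈Bu , refl) → proj₁ i∈Bu })
    where
    u≢0 : u ≢ zero
    u≢0 refl = n≮0 v<u

  v↝u : Anc T v u
  v↝u = anc-total-< (anc-trans v↝z z↝m) u↝m v<u

  head<v : ∀ {i} → InB T E v i → headℕ T E i ℕ.< toℕ v
  head<v (_ , h↝v , h≢v) = ≤∧≢⇒< (anc⇒≤ h↝v) (λ eq → h≢v (toℕ-injective eq))

  inB-u : ∀ {i} → InB T E v i → Anc T u (tail i) → InB T E u i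
  inB-u i∈Bv u↝t = u↝t , anc-trans (proj₁ (proj₂ i∈Bv)) v↝u
                  , λ { refl → <-irrefl refl (<-trans (head<v i∈Bv) v<u) }

  inB-v : ∀ {i} → Anc T v (tail i) → headℕ T E i ℕ.< toℕ v → InB T E v i
  inB-v {i} v↝t h<v = v↝t , anc-total-< (proj₁ (isBack i)) v↝t h<v , λ { refl → <-irrefl refl h<v }

  inB-u-if-tail≢z : ∀ {i} → InB T E v i → tail i ≢ z → InB T E u i
  inB-u-if-tail≢z i∈Bv ti≢z = inB-u i∈Bv (anc-trans u↝m (m↝tail i∈Bv ti≢z))

  inB-u-if-u↝z : Anc T u z → ∀ {i} → InB T E v i → InB T E u i
  inB-u-if-u↝z u↝z i∈Bv = inB-u i∈Bv (anc-trans u↝z (z↝tail i∈Bv))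

  ∉B-u-if-tail≡z : ¬ Anc T u z → ∀ {i} → tail i ≡ z → ¬ InB T E u i
  ∉B-u-if-tail≡z ¬u↝z ti≡z (u↝t , _) = ¬u↝z (subst (Anc T u) ti≡z u↝t)

  b-count-mono : (∀ {i} → InB T E v i → InB T E u i) → b-count T E v ≤ b-count T E u
  b-count-mono Bv⊆Bu = length-filter-mono (inB? T E v) (inB? T E u) (allFin k) (λ _ → Bv⊆Bu)

  module Backward (count≡ : b-count T E v ≡ b-count T E u + 1) (v≤l2 : toℕ v ≤ l2 T E z) where

    count< : b-count T E u ℕ.< b-count T E v
    count< = subst (b-count T E u ℕ.<_) (sym (trans count≡ (+-comm (b-count T E u) 1))) ≤-refl

    ¬u↝z : ¬ Anc T u z
    ¬u↝z u↝z = <⇒≱ count< (b-count-mono (inB-u-if-u↝z u↝z))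

    edge-from-z : ∃[ e ] (InB T E v e × tail e ≡ z)
    edge-from-z with any? (λ i → inB? T E v i ×-dec (tail i ≟ z))
    ... | yes found = found
    ... | no ∄edge = ⊥-elim (<⇒≱ count< (b-count-mono Bv⊆Bu))
      where
      Bv⊆Bu : ∀ {i} → InB T E v i → InB T E u i
      Bv⊆Bu {i} i∈Bv with tail i ≟ z
      ... | yes ti≡z = ⊥-elim (∄edge (i , i∈Bv , ti≡z))
      ... | no ti≢z  = inB-u-if-tail≢z i∈Bv ti≢z

    e : Fin k
    e = proj₁ edge-from-z

    e∈Bv : InB T E v e
    e∈Bv = proj₁ (proj₂ edge-from-z)

    tail-e≡z : tail e ≡ z
    tail-e≡z = proj₂ (proj₂ edge-from-z)

    edge-from-z-unique : ∀ {i} → InB T E v i → tail i ≡ z → i ≡ e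
    edge-from-z-unique {i} i∈Bv ti≡z with i ≟ e
    ... | yes i≡e = i≡e
    ... | no i≢e = ⊥-elim (<⇒≱ (two-edges-below⇒l2< two) v≤l2)
      where
      two : TwoEdgesBelow z (toℕ v)
      two = i , e , i≢e , ti≡z , tail-e≡z , head<v i∈Bv , head<v e∈Bv

    Bv⊆Bu∪e : ∀ i → InB T E v i → InB T E u i ⊎ i ≡ e
    Bv⊆Bu∪e i i∈Bv with tail i ≟ z
    ... | yes ti≡z = inj₂ (edge-from-z-unique i∈Bv ti≡z)
    ... | no ti≢z  = inj₁ (inB-u-if-tail≢z i∈Bv ti≢z)

    -- B(u) ⊄ B(v) would make |B(v)| < |B(u) ∪ {e}| ≤ |B(u)| + 1.
    Bu⊆Bv : ∀ {i} → InB T E u i → InB T E v i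
    Bu⊆Bv {i} i∈Bu with inB? T E v i
    ... | yes i∈Bv = i∈Bv
    ... | no i∉Bv = ⊥-elim (<⇒≱ count< (ℕ.s≤s⁻¹ (≤-trans count-Bv<Bu∪e count-Bu∪e≤1+Bu)))
      where
      Bu∪e? : Decidable (λ j → InB T E u j ⊎ j ≡ e)
      Bu∪e? j = inB? T E u j ⊎-dec (j ≟ e)

      count-Bv<Bu∪e : b-count T E v ℕ.< length (filter Bu∪e? (allFin k))
      count-Bv<Bu∪e = length-filter-mono-< (inB? T E v) Bu∪e? (allFin k) (Bv⊆Bu∪e _)
                        (∈-allFin i) (inj₁ i∈Bu) i∉Bv

      count-Bu∪e≤1+Bu : length (filter Bu∪e? (allFin k)) ≤ ℕ.suc (b-count T E u)
      count-Bu∪e≤1+Bu = length-filter-≤-suc Bu∪e? (inB? T E u) (allFin k) (allFin⁺ k) e (λ j∈ → j∈)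

    disjoint-union : ∃[ e ] DisjUnionOne T E v u e
    disjoint-union = e , Bv⊆Bu∪e , (λ { i (inj₁ i∈Bu) → Bu⊆Bv i∈Bu ; i (inj₂ refl) → e∈Bv })
                   , ∉B-u-if-tail≡z ¬u↝z tail-e≡z

  module Forward (e : Fin k) (Bv⊆Bu∪e : ∀ i → InB T E v i → InB T E u i ⊎ i ≡ e)
                 (Bu∪e⊆Bv : ∀ i → InB T E u i ⊎ i ≡ e → InB T E v i) (e∉Bu : ¬ InB T E u e) where

    e∈Bv : InB T E v e
    e∈Bv = Bu∪e⊆Bv e (inj₂ refl)

    ¬u↝z : ¬ Anc T u z
    ¬u↝z u↝z = e∉Bu (inB-u-if-u↝z u↝z e∈Bv)

    z≢m : z ≢ m
    z≢m refl = ¬u↝z u↝m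

    count≡ : b-count T E v ≡ b-count T E u + 1
    count≡ = trans (≤-antisym
        (length-filter-≤-suc (inB? T E v) (inB? T E u) (allFin k) (allFin⁺ k) e (Bv⊆Bu∪e _))
        (length-filter-mono-< (inB? T E u) (inB? T E v) (allFin k)
                              (λ i∈Bu → Bu∪e⊆Bv _ (inj₁ i∈Bu)) (∈-allFin e) e∈Bv e∉Bu))
      (+-comm 1 (b-count T E u))

    edge-from-z-below-v : ∀ {i} → tail i ≡ z → headℕ T E i ℕ.< toℕ v → i ≡ e
    edge-from-z-below-v ti≡z h<v with Bv⊆Bu∪e _ (inB-v (subst (Anc T v) (sym ti≡z) v↝z) h<v)
    ... | inj₁ i∈Bu = ⊥-elim (∉B-u-if-tail≡z ¬u↝z ti≡z i∈Bu)
    ... | inj₂ i≡e  = i≡e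

    v≤l2 : toℕ v ≤ l2 T E z
    v≤l2 = ≮⇒≥ λ l2<v →
      let a , b , a≢b , ta , tb , ha , hb = l2<⇒two-edges-below (anc⇒≤ v↝z) l2<v
      in a≢b (trans (edge-from-z-below-v ta ha) (sym (edge-from-z-below-v tb hb)))

    -- Such a child carries an edge of B(v) with tail strictly below z, hence below m.
    child-low1<v⇒anc-m : ∀ {c} → IsChild z c → low1 T E c ℕ.< toℕ v → Anc T c m
    child-low1<v⇒anc-m child low1<v =
      let z↝c = child-anc child
          i , (c↝t , _) , h<v = low1<⇒edge-below (anc⇒≤ (anc-trans v↝z z↝c)) low1<v
          i∈Bv = inB-v (anc-trans v↝z (anc-trans z↝c c↝t)) h<v
          ti≢z = λ ti≡z → child-¬anc-parent child (subst (Anc T _) ti≡z c↝t)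
      in child-anc-descendant child z↝m z≢m (m↝tail i∈Bv ti≢z) c↝t

    low2-child-condition : c2 T E z ≡ nothing ⊎ ∃[ c ] (c2 T E z ≡ just c × toℕ v ≤ low1 T E c)
    low2-child-condition with c2 T E z in eq
    ... | nothing = inj₁ refl
    ... | just c′ = inj₂ (c′ , refl , ≮⇒≥ λ low1<v →
          let child′ , c , child , c≢c′ , low1≤ = c2-just eq
          in c≢c′ (children-anc-unique child child′
                     (child-low1<v⇒anc-m child (≤-<-trans low1≤ low1<v))
                     (child-low1<v⇒anc-m child′ low1<v)))

lemma6 : ∀ {n k} (T : RootedTree n) (E : BackEdges T k)
    → IsPreorder T
    → ThreeEdgeConnected T E
    → (M : Vertex n → Vertex n)
    → (∀ w → w ≢ zero → IsNCA T (TailsB T E w) (M w))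
    → (v : Vertex n) → v ≢ zero
    → (m : Vertex n) → IsNCA T (TailsB-below T E v (M v)) m
    → (u : Vertex n) → M u ≡ m → v < u
    → (∀ w → M w ≡ m → v < w → toℕ u ≤ toℕ w)
    → (∃[ e ] DisjUnionOne T E v u e)
      ⇔ (b-count T E v ≡ b-count T E u + 1
         × toℕ v ≤ l2 T E (M v)
         × (c2 T E (M v) ≡ nothing
            ⊎ ∃[ c ] (c2 T E (M v) ≡ just c × toℕ v ≤ low1 T E c)))
lemma6 T E _ _ M M-nca v v≢0 m m-nca u Mu≡m v<u _ = mk⇔
  (λ (e , Bv⊆Bu∪e , Bu∪e⊆Bv , e∉Bu) →
     let open Forward e Bv⊆Bu∪e Bu∪e⊆Bv e∉Bu in count≡ , v≤l2 , low2-child-condition)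
  (λ (count≡ , v≤l2 , _) → Backward.disjoint-union count≡ v≤l2)
  where open Setting T E M M-nca v v≢0 m m-nca u Mu≡m v<u
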